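{- Let $D=(G,\mathcal{O},w)$ be a weighted oriented graph and $C=(a_1',a_1,b_1,b_1',c_1,a_1')$ a basic $5$-cycle of $G$ such that $(a_1',a_1)\in E(D)$, $\deg_G(a_1)\ge3$, $\deg_G(c_1)\ge3$ and $w(b_1)=1$. If there is a strong vertex cover $\mathcal{C}$ of $D$ with $V(C)\subseteq\mathcal{C}$, then $C$ does not have the $\star$-property.
   Context: A weighted oriented graph is a triple $D=(G,\mathcal{O},w)$ with $G$ a finite simple graph, $\mathcal{O}$ an orientation of its edges, $w:V(G)\to\mathbb{N}$; $E(D)$ is the set of oriented edges. $V^{+}=\{x\mid w(x)>1\}$. $N_D^{+}(x)=\{y\mid(x,y)\in E(D)\}$, $N_D^{ - }(x)=\{y\mid(y,x)\in E(D)\}$, $N_D(x)=N_D^+(x)\cup N_D^-(x)$, $\deg_G(x)=|N_D(x)|$. Standing convention: every source (vertex with $N_D^-(x)=\emptyset$) has weight $1$. A vertex cover of $D$ is a set of vertices meeting every edge. For a vertex cover $\mathcal{C}$: $L_1(\mathcal{C})=\{x\in\mathcal{C}\mid N_D^+(x)\setminus\mathcal{C}\ne\emptyset\}$, $L_2(\mathcal{C})=\{x\in\mathcal{C}\setminus L_1(\mathcal{C})\mid N_D^-(x)\setminus\mathcal{C}\ne\emptyset\}$, $L_3(\mathcal{C})=\mathcal{C}\setminus(L_1(\mathcal{C})\cup L_2(\mathcal{C}))$. $\mathcal{C}$ is strong if for every $x\in L_3(\mathcal{C})$ there is $(y,x)\in E(D)$ with $y\in(\mathcal{C}\setminus L_1(\mathcal{C}))\cap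 V^+$. A basic $5$-cycle is an induced $5$-cycle of $G$ containing no two adjacent vertices both of degree $\ge3$ in $G$. An induced $5$-cycle $C$ has the $\star$-property if for each $(a,b)\in E(D)$ that is an edge of $C$ with $a\in V^+$, writing $C=(a',a,b,b',c,a')$: ($\star$.1) $(a',a)\in E(D)$ and $w(a')=1$; ($\star$.2) $N_D^-(a)\subseteq N_D(c)$ and $N_D^-(a)\cap V^+\subseteq N_D^-(c)$; ($\star$.3) $N_D(b')\subseteq N_D(a')\cup N_D^+(a)$ and $N_D^-(b')\cap V^+\subseteq N_D^-(a')$. -}

module Defs where

open import Data.Nat using (ℕ; _≤_; _<_)
open import Data.Bool using (Bool; true; false; _∨_)
open import Data.Fin using (Fin; zero; suc)
open import Data.Fin.Subset using (Subset; _∈_; _∉_; ∣_∣)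
open import Data.Vec using (tabulate)
open import Data.Product using (Σ; ∃; _×_; _,_)
open import Data.Sum using (_⊎_)
open import Relation.Nullary using (¬_)
open import Relation.Binary.PropositionalEquality using (_≡_; _≢_)
open import Function.Definitions using (Injective)

-- Weighted oriented graph on vertex set Fin n.
-- arc x y ≡ true  means (x , y) ∈ E(D).
record WOG (n : ℕ) : Set where
  field
    arc        : Fin n → Fin n → Bool
    w          : Fin n → ℕ
    irrefl     : ∀ x → arc x x ≡ false
    oriented   : ∀ x y → arc x y ≡ true → arc y x ≡ false
    w-pos      : ∀ x → 1 ≤ w x
    source-w1  : ∀ x → (∀ y → arc y x ≡ false) → w x ≡ 1

module _ {n : ℕ} (D : WOG n) where
  open WOG D

  Arc : Fin n → Fin n → Set
  Arc x y = arc x y ≡ true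

  adj : Fin n → Fin n → Bool
  adj x y = arc x y ∨ arc y x

  Adj : Fin n → Fin n → Set
  Adj x y = adj x y ≡ true

  InVplus : Fin n → Set
  InVplus x = 1 < w x

  nbhd : Fin n → Subset n
  nbhd x = tabulate (λ y → adj x y)

  deg : Fin n → ℕ
  deg x = ∣ nbhd x ∣

  IsVertexCover : Subset n → Set
  IsVertexCover C = ∀ x y → Arc x y → x ∈ C ⊎ y ∈ C

  L₁ : Subset n → Fin n → Set
  L₁ C x = x ∈ C × ∃ λ y → Arc x y × y ∉ C

  L₂ : Subset n → Fin n → Set
  L₂ C x = x ∈ C × ¬ L₁ C x × ∃ λ y → Arc y x × y ∉ C

  L₃ : Subset n → Fin n → Set
  L₃ C x = x ∈ C × ¬ L₁ C x × ¬ L₂ C x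

  IsStrongVertexCover : Subset n → Set
  IsStrongVertexCover C =
    IsVertexCover C ×
    (∀ x → L₃ C x → ∃ λ y → Arc y x × (y ∈ C × ¬ L₁ C y) × InVplus y)

  suc5 : Fin 5 → Fin 5
  suc5 zero = suc zero
  suc5 (suc zero) = suc (suc zero)
  suc5 (suc (suc zero)) = suc (suc (suc zero))
  suc5 (suc (suc (suc zero))) = suc (suc (suc (suc zero)))
  suc5 (suc (suc (suc (suc zero)))) = zero

  pred5 : Fin 5 → Fin 5
  pred5 zero = suc (suc (suc (suc zero)))
  pred5 (suc zero) = zero
  pred5 (suc (suc zero)) = suc zero
  pred5 (suc (suc (suc zero))) = suc (suc zero)
  pred5 (suc (suc (suc (suc zero)))) = suc (suc (suc zero))

  cyc : Fin n → Fin n → Fin n → Fin n → Fin n → Fin 5 → Fin n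
  cyc v₀ v₁ v₂ v₃ v₄ zero = v₀
  cyc v₀ v₁ v₂ v₃ v₄ (suc zero) = v₁
  cyc v₀ v₁ v₂ v₃ v₄ (suc (suc zero)) = v₂
  cyc v₀ v₁ v₂ v₃ v₄ (suc (suc (suc zero))) = v₃
  cyc v₀ v₁ v₂ v₃ v₄ (suc (suc (suc (suc zero)))) = v₄

  IsInduced5Cycle : (Fin 5 → Fin n) → Set
  IsInduced5Cycle f =
    Injective _≡_ _≡_ f ×
    (∀ i → Adj (f i) (f (suc5 i))) ×
    (∀ i → ¬ Adj (f i) (f (suc5 (suc5 i))))

  -- basic 5-cycle: induced, and no two adjacent (on the cycle, equivalently
  -- in G since it is induced) vertices both of degree ≥ 3 in G.
  IsBasic5Cycle : (Fin 5 → Fin n) → Set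
  IsBasic5Cycle f =
    IsInduced5Cycle f ×
    (∀ i → ¬ (3 ≤ deg (f i) × 3 ≤ deg (f (suc5 i))))

  -- The ⋆-conditions for the oriented edge (a , b) with C = (a', a, b, b', c, a')
  Star1 : Fin n → Fin n → Set
  Star1 a' a = Arc a' a × w a' ≡ 1

  Star2 : Fin n → Fin n → Set
  Star2 a c =
    (∀ y → Arc y a → Adj y c) ×
    (∀ y → Arc y a → InVplus y → Arc y c)

  Star3 : Fin n → Fin n → Fin n → Set
  Star3 a' a b' =
    (∀ y → Adj y b' → Adj y a' ⊎ Arc a y) ×
    (∀ y → Arc y b' → InVplus y → Arc y a')

  StarAt : Fin n → Fin n → Fin n → Fin n → Fin n → Set
  StarAt a' a b b' c =
    Arc a b → InVplus a → Star1 a' a × Star2 a c × Star3 a' a b'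

  -- ⋆-property of the cycle f: for every edge of the cycle, in each of its two
  -- possible orientations (a,b), with a', b', c read off the cycle.
  HasStarProperty : (Fin 5 → Fin n) → Set
  HasStarProperty f =
    ∀ i →
      StarAt (f (pred5 i)) (f i) (f (suc5 i)) (f (suc5 (suc5 i))) (f (suc5 (suc5 (suc5 i))))
      × StarAt (f (suc5 i)) (f i) (f (pred5 i)) (f (pred5 (pred5 i))) (f (suc5 (suc5 i)))

-- a' and b' are the neighbours of c on C; since C is basic and deg c ≥ 3, both have
-- degree 2, so their whole neighbourhoods lie in V(C) ⊆ 𝒞 and both lie in L₃(𝒞).
-- Strongness at a' forces a heavy in-neighbour, which cannot be a (as (a', a) ∈ E(D)),
-- so c ∈ V⁺ and (c, a') ∈ E(D). Applying (⋆.1) to the oriented cycle edge (c, a')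
-- gives (b', c) ∈ E(D). Strongness at b' now needs a heavy in-neighbour among b, c:
-- but w(b) = 1 and (c, b') ∉ E(D).
module Submission where

open import Defs
open import Data.Nat using (ℕ; _≤_; _<_; s≤s; z≤n)
open import Data.Nat.Properties using (≤-trans; <-irrefl)
open import Data.Fin using (Fin; zero; suc; _≟_)
open import Data.Fin.Subset using (Subset; _∈_; ∣_∣; _-_)
open import Data.Fin.Subset.Properties using (x∈p⇒∣p-x∣<∣p∣; x∈p∧x≢y⇒x∈p-y)
open import Data.Vec.Properties using (lookup⇒[]=; lookup∘tabulate)
open import Data.Bool.Properties using (∨-comm)
open import Data.Product using (_×_; _,_; proj₁; proj₂; ∃)
open import Data.Sum using (_⊎_; inj₁; inj₂)
open import Data.Empty using (⊥-elim)
open import Function using (_∘_)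
open import Relation.Nullary using (¬_; yes; no)
open import Relation.Binary.PropositionalEquality using (_≡_; _≢_; refl; sym; trans)

three-distinct⇒3≤∣p∣ : ∀ {n} {p : Subset n} {x y z : Fin n} →
  x ≢ y → x ≢ z → y ≢ z → x ∈ p → y ∈ p → z ∈ p → 3 ≤ ∣ p ∣
three-distinct⇒3≤∣p∣ {p = p} {x} {y} {z} x≢y x≢z y≢z x∈p y∈p z∈p =
  ≤-trans (s≤s (≤-trans (s≤s (≤-trans (s≤s z≤n) ∣p-x-y-z∣<∣p-x-y∣)) ∣p-x-y∣<∣p-x∣)) ∣p-x∣<∣p∣
  where
  ∣p-x∣<∣p∣ : ∣ p - x ∣ < ∣ p ∣
  ∣p-x∣<∣p∣ = x∈p⇒∣p-x∣<∣p∣ x∈p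
  ∣p-x-y∣<∣p-x∣ : ∣ p - x - y ∣ < ∣ p - x ∣
  ∣p-x-y∣<∣p-x∣ = x∈p⇒∣p-x∣<∣p∣ (x∈p∧x≢y⇒x∈p-y y∈p (x≢y ∘ sym))
  ∣p-x-y-z∣<∣p-x-y∣ : ∣ p - x - y - z ∣ < ∣ p - x - y ∣
  ∣p-x-y-z∣<∣p-x-y∣ =
    x∈p⇒∣p-x∣<∣p∣ (x∈p∧x≢y⇒x∈p-y (x∈p∧x≢y⇒x∈p-y z∈p (x≢z ∘ sym)) (y≢z ∘ sym))

module _ {n : ℕ} (D : WOG n) where
  open WOG D

  Adj-sym : ∀ {x y} → Adj D x y → Adj D y x
  Adj-sym {x} {y} x~y = trans (∨-comm (arc y x) (arc x y)) x~y

  Arc⇒Adj : ∀ {x y} → Arc D x y → Adj D x y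
  Arc⇒Adj x→y rewrite x→y = refl

  Arc⇒Adj˘ : ∀ {x y} → Arc D x y → Adj D y x
  Arc⇒Adj˘ = Adj-sym ∘ Arc⇒Adj

  Arc-asym : ∀ {x y} → Arc D x y → ¬ Arc D y x
  Arc-asym {x} {y} x→y y→x with trans (sym y→x) (oriented x y x→y)
  ... | ()

  Adj⇒∈nbhd : ∀ {v y} → Adj D v y → y ∈ nbhd D v
  Adj⇒∈nbhd {v} {y} v~y = lookup⇒[]= y (nbhd D v) (trans (lookup∘tabulate (adj D v) y) v~y)

  deg<3⇒nbhd⊆pair : ∀ {v u₁ u₂} → ¬ 3 ≤ deg D v → u₁ ≢ u₂ → Adj D v u₁ → Adj D v u₂ →
                    ∀ {y} → Adj D v y → y ≡ u₁ ⊎ y ≡ u₂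
  deg<3⇒nbhd⊆pair {u₁ = u₁} {u₂} deg<3 u₁≢u₂ v~u₁ v~u₂ {y} v~y with y ≟ u₁ | y ≟ u₂
  ... | yes y≡u₁ | _        = inj₁ y≡u₁
  ... | no _     | yes y≡u₂ = inj₂ y≡u₂
  ... | no y≢u₁  | no y≢u₂  =
    ⊥-elim (deg<3 (three-distinct⇒3≤∣p∣ y≢u₁ y≢u₂ u₁≢u₂
                     (Adj⇒∈nbhd v~y) (Adj⇒∈nbhd v~u₁) (Adj⇒∈nbhd v~u₂)))

  nbhd⊆cover⇒L₃ : ∀ {𝒞 v} → v ∈ 𝒞 → (∀ {y} → Adj D v y → y ∈ 𝒞) → L₃ D 𝒞 v
  nbhd⊆cover⇒L₃ v∈𝒞 nbhd⊆𝒞 =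
    v∈𝒞 , (λ { (_ , _ , v→y , y∉𝒞) → y∉𝒞 (nbhd⊆𝒞 (Arc⇒Adj v→y)) })
        , (λ { (_ , _ , _ , y→v , y∉𝒞) → y∉𝒞 (nbhd⊆𝒞 (Arc⇒Adj˘ y→v)) })

  strong⇒heavy-in-neighbour :
    ∀ {𝒞 v u₁ u₂} → IsStrongVertexCover D 𝒞 →
    ¬ 3 ≤ deg D v → u₁ ≢ u₂ → Adj D v u₁ → Adj D v u₂ →
    v ∈ 𝒞 → u₁ ∈ 𝒞 → u₂ ∈ 𝒞 →
    (Arc D u₁ v × InVplus D u₁) ⊎ (Arc D u₂ v × InVplus D u₂)
  strong⇒heavy-in-neighbour {𝒞} {v} {u₁} {u₂} (_ , strong) deg<3 u₁≢u₂ v~u₁ v~u₂ v∈𝒞 u₁∈𝒞 u₂∈𝒞 =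
    heavy-in-pair (strong v (nbhd⊆cover⇒L₃ v∈𝒞 nbhd⊆𝒞))
    where
    nbhd⊆pair : ∀ {y} → Adj D v y → y ≡ u₁ ⊎ y ≡ u₂
    nbhd⊆pair = deg<3⇒nbhd⊆pair deg<3 u₁≢u₂ v~u₁ v~u₂

    nbhd⊆𝒞 : ∀ {y} → Adj D v y → y ∈ 𝒞
    nbhd⊆𝒞 v~y with nbhd⊆pair v~y
    ... | inj₁ refl = u₁∈𝒞
    ... | inj₂ refl = u₂∈𝒞

    heavy-in-pair : (∃ λ y → Arc D y v × (y ∈ 𝒞 × ¬ L₁ D 𝒞 y) × InVplus D y) →
                    (Arc D u₁ v × InVplus D u₁) ⊎ (Arc D u₂ v × InVplus D u₂)
    heavy-in-pair (y , y→v , _ , y∈V⁺) with nbhd⊆pair (Arc⇒Adj˘ y→v)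
    ... | inj₁ refl = inj₁ (y→v , y∈V⁺)
    ... | inj₂ refl = inj₂ (y→v , y∈V⁺)

lemma4p5 : {n : ℕ} (D : WOG n) (a₁' a₁ b₁ b₁' c₁ : Fin n) →
    IsBasic5Cycle D (cyc D a₁' a₁ b₁ b₁' c₁) →
    Arc D a₁' a₁ →
    3 ≤ deg D a₁ →
    3 ≤ deg D c₁ →
    WOG.w D b₁ ≡ 1 →
    (𝒞 : Subset n) → IsStrongVertexCover D 𝒞 →
    (∀ i → cyc D a₁' a₁ b₁ b₁' c₁ i ∈ 𝒞) →
    ¬ HasStarProperty D (cyc D a₁' a₁ b₁ b₁' c₁)
lemma4p5 D a' a b b' c ((injective , adjacent , _) , basic) a'→a _ 3≤deg-c w-b≡1 𝒞 strong cover star =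
  no-heavy-in-neighbour-of-b'
    (strong⇒heavy-in-neighbour D strong (basic 3F ∘ (_, 3≤deg-c)) b≢c
       (Adj-sym D (adjacent 2F)) (adjacent 3F) (cover 3F) (cover 2F) (cover 4F))
  where
  0F 1F 2F 3F 4F : Fin 5
  0F = zero
  1F = suc zero
  2F = suc (suc zero)
  3F = suc (suc (suc zero))
  4F = suc (suc (suc (suc zero)))

  a≢c : a ≢ c
  a≢c a≡c with injective {1F} {4F} a≡c
  ... | ()

  b≢c : b ≢ c
  b≢c b≡c with injective {2F} {4F} b≡c
  ... | ()

  c→a'-heavy : Arc D c a' × InVplus D c
  c→a'-heavy with strong⇒heavy-in-neighbour D strong (basic 4F ∘ (3≤deg-c ,_)) a≢c
                    (adjacent 0F) (Adj-sym D (adjacent 4F)) (cover 0F) (cover 1F) (cover 4F)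
  ... | inj₁ (a→a' , _) = ⊥-elim (Arc-asym D a'→a a→a')
  ... | inj₂ c→a'-heavy = c→a'-heavy

  b'→c : Arc D b' c
  b'→c = proj₁ (proj₁ (proj₁ (star 4F) (proj₁ c→a'-heavy) (proj₂ c→a'-heavy)))

  no-heavy-in-neighbour-of-b' : ¬ ((Arc D b b' × InVplus D b) ⊎ (Arc D c b' × InVplus D c))
  no-heavy-in-neighbour-of-b' (inj₁ (_ , b∈V⁺)) = <-irrefl (sym w-b≡1) b∈V⁺
  no-heavy-in-neighbour-of-b' (inj₂ (c→b' , _)) = Arc-asym D b'→c c→b'
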